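{- Let $p_1,p_2$ be nonzero constants and let $(\tilde F^{(2)}_n)_{n\in\mathbb Z}$ be defined by $\tilde F^{(2)}_0=0$, $\tilde F^{(2)}_1=1$, and $\tilde F^{(2)}_{n}=p_1\tilde F^{(2)}_{n-1}+p_2\tilde F^{(2)}_{n-2}$ for all integers $n$. Then for all integers $m\ge1$ and $n\ge0$: $$\sum_{j=0}^n p_2^{\,n-j+1}\binom nj\left(\tilde F^{(2)}_m\right)^j\left(\tilde F^{(2)}_{m-1}\right)^{n-j}\tilde F^{(2)}_{j-mn-1}=1,$$ $$\sum_{j=0}^n p_2^{\,n-j}\binom nj\left(\tilde F^{(2)}_m\right)^j\left(\tilde F^{(2)}_{m-1}\right)^{n-j}\tilde F^{(2)}_{j-mn}=0,$$ $$\sum_{j=0}^n p_2^{\,n-j}\binom nj\left(\tilde F^{(2)}_m\right)^j\left(\tilde F^{(2)}_{m-1}\right)^{n-j}\tilde F^{(2)}_{j-mn+1}=1.$$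
   Context: Convention: $0^0=1$. -}

module Defs where

open import Level using (_⊔_)
open import Algebra.Bundles using (CommutativeRing)
open import Data.Nat as ℕ using (ℕ; zero; suc)
open import Data.Nat.Combinatorics using (_C_)
open import Relation.Nullary using (¬_)
open import Data.Product using (Σ; _×_)

module RingOps {c ℓ} (R : CommutativeRing c ℓ) where
  open CommutativeRing R

  pow : Carrier → ℕ → Carrier
  pow x zero    = 1#
  pow x (suc k) = x * pow x k

  fromℕ : ℕ → Carrier
  fromℕ zero    = 0#
  fromℕ (suc k) = 1# + fromℕ k

  sumTo : ℕ → (ℕ → Carrier) → Carrier
  sumTo zero    f = f 0
  sumTo (suc n) f = sumTo n f + f (suc n)

  binom : ℕ → ℕ → Carrier
  binom n j = fromℕ (n C j)

IsField : ∀ {c ℓ} → CommutativeRing c ℓ → Set (c ⊔ ℓ)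
IsField R = ¬ (1# ≈ 0#) × (∀ x → ¬ (x ≈ 0#) → Σ Carrier λ y → x * y ≈ 1#)
  where open CommutativeRing R

-- Let E be the shift f ↦ f ∘ suc.  The addition formula F (k + m) = Fₘ F (k + 1) + p₂ Fₘ₋₁ F k
-- says that on F the shift by m acts as Eᵐ = a E + c with a = Fₘ, c = p₂ Fₘ₋₁, hence
-- Eᵐⁿ = (a E + c)ⁿ = Σⱼ C(n,j) aʲ cⁿ⁻ʲ Eʲ.  Applied to F at -mn + d this gives F d, and
-- d = -1, 0, 1 yield the three identities since p₂ F₋₁ = 1 is the recurrence at 1.
module Submission where

open import Defs
open import Algebra.Bundles using (CommutativeRing)
open import Data.Nat using (ℕ; zero; suc; _≤_; _<_; _∸_; s≤s; _<?_)
import Data.Nat as ℕ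
import Data.Nat.Properties as ℕₚ
open import Data.Nat.Combinatorics using (_C_; k>n⇒nCk≡0; nCk+nC[k+1]≡[n+1]C[k+1])
open import Data.Integer using (ℤ; +_; -[1+_]) renaming (_+_ to _+ℤ_; _-_ to _-ℤ_; _*_ to _*ℤ_; -_ to -ℤ_)
import Data.Integer.Properties as ℤₚ
open import Data.Integer.Tactic.RingSolver using (solve-∀)
open import Data.Maybe using (nothing)
open import Data.Product using (_×_; _,_)
open import Function using (_∘_)
open import Relation.Nullary using (¬_; yes; no)
open import Relation.Binary.PropositionalEquality using (_≡_; cong; cong₂) renaming (sym to sym≡)
import Relation.Binary.Reasoning.Setoid as ≈-Reasoning
open import Tactic.RingSolver.Core.AlmostCommutativeRing using (fromCommutativeRing)

1+x+r≡x+[r+1] : ∀ x r → (+ 1 +ℤ x) +ℤ r ≡ x +ℤ (r +ℤ + 1)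
1+x+r≡x+[r+1] = solve-∀

s*n+r+s≡s*[1+n]+r : ∀ s n r → s *ℤ n +ℤ r +ℤ s ≡ s *ℤ (+ 1 +ℤ n) +ℤ r
s*n+r+s≡s*[1+n]+r = solve-∀

x+[-x+d]≡d : ∀ x d → x +ℤ (-ℤ x +ℤ d) ≡ d
x+[-x+d]≡d = solve-∀

k+[1+x]≡k+1+x : ∀ k x → k +ℤ (+ 1 +ℤ x) ≡ k +ℤ + 1 +ℤ x
k+[1+x]≡k+1+x = solve-∀

k+1+1-1≡k+1 : ∀ k → k +ℤ + 1 +ℤ + 1 -ℤ + 1 ≡ k +ℤ + 1
k+1+1-1≡k+1 = solve-∀

k+1+1-2≡k : ∀ k → k +ℤ + 1 +ℤ + 1 -ℤ + 2 ≡ k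
k+1+1-2≡k = solve-∀

1+x-2≡x-1 : ∀ x → + 1 +ℤ x -ℤ + 2 ≡ x -ℤ + 1
1+x-2≡x-1 = solve-∀

module RingLemmas {c ℓ} (R : CommutativeRing c ℓ) where
  open CommutativeRing R
  open RingOps R
  open ≈-Reasoning setoid
  open import Tactic.RingSolver.NonReflective (fromCommutativeRing R (λ _ → nothing))
    using (solve; _⊕_; _⊗_) renaming (_⊜_ to infix 4 _⊜_)
  open import Algebra.Properties.CommutativeSemigroup *-commutativeSemigroup using (x∙yz≈y∙xz; interchange)
  open import Algebra.Properties.CommutativeSemigroup +-commutativeSemigroup using () renaming (interchange to +-interchange)
  open import Algebra.Solver.CommutativeMonoid *-commutativeMonoid using ()
    renaming (solve to *-solve; _⊕_ to _·_; _⊜_ to _≐_)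

  fromℕ-+ : ∀ a b → fromℕ (a ℕ.+ b) ≈ fromℕ a + fromℕ b
  fromℕ-+ zero    b = sym (+-identityˡ _)
  fromℕ-+ (suc a) b = trans (+-congˡ (fromℕ-+ a b)) (sym (+-assoc _ _ _))

  binom-pascal : ∀ n j → binom (suc n) (suc j) ≈ binom n j + binom n (suc j)
  binom-pascal n j = begin
    fromℕ (suc n C suc j)           ≡⟨ cong fromℕ (nCk+nC[k+1]≡[n+1]C[k+1] n j) ⟨
    fromℕ (n C j ℕ.+ n C suc j)     ≈⟨ fromℕ-+ (n C j) (n C suc j) ⟩
    binom n j + binom n (suc j)     ∎

  binom-vanish : ∀ {n k} → n < k → binom n k ≈ 0#
  binom-vanish n<k = reflexive (cong fromℕ (k>n⇒nCk≡0 n<k))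

  pow-distribʳ-* : ∀ x y k → pow (x * y) k ≈ pow x k * pow y k
  pow-distribʳ-* x y zero    = sym (*-identityˡ _)
  pow-distribʳ-* x y (suc k) = begin
    x * y * pow (x * y) k         ≈⟨ *-congˡ (pow-distribʳ-* x y k) ⟩
    x * y * (pow x k * pow y k)   ≈⟨ interchange x y (pow x k) (pow y k) ⟩
    x * pow x k * (y * pow y k)   ∎

  pow-∸-suc : ∀ x {n j} → j < n → pow x (n ∸ j) ≈ x * pow x (n ∸ suc j)
  pow-∸-suc x {suc n} {zero}  _         = refl
  pow-∸-suc x {suc n} {suc j} (s≤s j<n) = pow-∸-suc x j<n

  -- When j ≥ n the exponent n ∸ j is truncated, but then the coefficient vanishes.
  binom-pow-∸-suc : ∀ x n j → binom n (suc j) * pow x (n ∸ j) ≈ x * (binom n (suc j) * pow x (n ∸ suc j))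
  binom-pow-∸-suc x n j with j <? n
  ... | yes j<n = trans (*-congˡ (pow-∸-suc x j<n)) (x∙yz≈y∙xz _ x _)
  ... | no  j≮n = begin
    binom n (suc j) * pow x (n ∸ j)               ≈⟨ trans (*-congʳ vanish) (zeroˡ _) ⟩
    0#                                            ≈⟨ sym (trans (*-congˡ (trans (*-congʳ vanish) (zeroˡ _))) (zeroʳ x)) ⟩
    x * (binom n (suc j) * pow x (n ∸ suc j))     ∎
    where
    vanish : binom n (suc j) ≈ 0#
    vanish = binom-vanish (s≤s (ℕₚ.≮⇒≥ j≮n))

  pow-suc-pull : ∀ x k a b d e → pow x (k ℕ.+ 1) * a * b * d * e ≈ x * (pow x k * a * b * d * e)
  pow-suc-pull x k a b d e = begin
    pow x (k ℕ.+ 1) * a * b * d * e   ≡⟨ cong (λ i → pow x i * a * b * d * e) (ℕₚ.+-comm k 1) ⟩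
    x * pow x k * a * b * d * e       ≈⟨ *-solve 6 (λ x u a b d e → ((((x · u) · a) · b) · d) · e ≐ x · ((((u · a) · b) · d) · e)) refl x (pow x k) a b d e ⟩
    x * (pow x k * a * b * d * e)     ∎

  sumTo-cong : ∀ n {f g : ℕ → Carrier} → (∀ j → f j ≈ g j) → sumTo n f ≈ sumTo n g
  sumTo-cong zero    f≈g = f≈g 0
  sumTo-cong (suc n) f≈g = +-cong (sumTo-cong n f≈g) (f≈g (suc n))

  sumTo-distrib-+ : ∀ n f g → sumTo n (λ j → f j + g j) ≈ sumTo n f + sumTo n g
  sumTo-distrib-+ zero    f g = refl
  sumTo-distrib-+ (suc n) f g = trans (+-congʳ (sumTo-distrib-+ n f g)) (+-interchange _ _ _ _)

  *-distribˡ-sumTo : ∀ n x f → x * sumTo n f ≈ sumTo n (λ j → x * f j)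
  *-distribˡ-sumTo zero    x f = refl
  *-distribˡ-sumTo (suc n) x f = trans (distribˡ x _ _) (+-congʳ (*-distribˡ-sumTo n x f))

  sumTo-unfoldˡ : ∀ n f → sumTo (suc n) f ≈ f 0 + sumTo n (f ∘ suc)
  sumTo-unfoldˡ zero    f = refl
  sumTo-unfoldˡ (suc n) f = trans (+-congʳ (sumTo-unfoldˡ n f)) (+-assoc _ _ _)

  module BinomialSum (a c : Carrier) where
    term : ℕ → (ℕ → Carrier) → ℕ → Carrier
    term n f j = binom n j * pow a j * pow c (n ∸ j) * f j

    binomialSum : ℕ → (ℕ → Carrier) → Carrier
    binomialSum n f = sumTo n (term n f)

    -- suc n C 0 and n C 0 both compute to 1.
    term-zero : ∀ n f → term (suc n) f 0 ≈ c * term n f 0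
    term-zero n f = *-solve 5 (λ c B u P Y → ((B · u) · (c · P)) · Y ≐ c · (((B · u) · P) · Y))
      refl c (binom n 0) 1# (pow c n) (f 0)

    term-suc : ∀ n f j → term (suc n) f (suc j) ≈ a * term n (f ∘ suc) j + c * term n f (suc j)
    term-suc n f j = begin
      binom (suc n) (suc j) * (a * pow a j) * pow c (n ∸ j) * f (suc j)
        ≈⟨ *-congʳ (*-congʳ (*-congʳ (binom-pascal n j))) ⟩
      (B + B′) * (a * pow a j) * pow c (n ∸ j) * f (suc j)
        ≈⟨ trans (*-congʳ (*-congʳ (distribʳ _ B B′))) (trans (*-congʳ (distribʳ _ _ _)) (distribʳ _ _ _)) ⟩
      B * (a * pow a j) * pow c (n ∸ j) * f (suc j) + B′ * (a * pow a j) * pow c (n ∸ j) * f (suc j)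
        ≈⟨ +-cong (*-solve 5 (λ a B P Q Y → ((B · (a · P)) · Q) · Y ≐ a · (((B · P) · Q) · Y))
                    refl a B (pow a j) (pow c (n ∸ j)) (f (suc j)))
                  (*-solve 4 (λ B′ X Q Y → ((B′ · X) · Q) · Y ≐ ((B′ · Q) · X) · Y)
                    refl B′ (a * pow a j) (pow c (n ∸ j)) (f (suc j))) ⟩
      a * term n (f ∘ suc) j + B′ * pow c (n ∸ j) * (a * pow a j) * f (suc j)
        ≈⟨ +-congˡ (*-congʳ (*-congʳ (binom-pow-∸-suc c n j))) ⟩
      a * term n (f ∘ suc) j + c * (B′ * pow c (n ∸ suc j)) * (a * pow a j) * f (suc j)
        ≈⟨ +-congˡ (*-solve 5 (λ c B Q P Y → ((c · (B · Q)) · P) · Y ≐ c · (((B · P) · Q) · Y))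
             refl c B′ (pow c (n ∸ suc j)) (a * pow a j) (f (suc j))) ⟩
      a * term n (f ∘ suc) j + c * term n f (suc j) ∎
      where
      B B′ : Carrier
      B  = binom n j
      B′ = binom n (suc j)

    term-vanish : ∀ n f → term n f (suc n) ≈ 0#
    term-vanish n f = trans (*-congʳ (*-congʳ (*-congʳ (binom-vanish (ℕₚ.n<1+n n)))))
      (trans (*-congʳ (*-congʳ (zeroˡ _))) (trans (*-congʳ (zeroˡ _)) (zeroˡ _)))

    binomialSum-cong : ∀ n {f g} → (∀ j → f j ≈ g j) → binomialSum n f ≈ binomialSum n g
    binomialSum-cong n f≈g = sumTo-cong n (λ j → *-congˡ (f≈g j))

    binomialSum-suc : ∀ n f → binomialSum (suc n) f ≈ a * binomialSum n (f ∘ suc) + c * binomialSum n f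
    binomialSum-suc n f = begin
      binomialSum (suc n) f
        ≈⟨ sumTo-unfoldˡ n (term (suc n) f) ⟩
      term (suc n) f 0 + sumTo n (λ j → term (suc n) f (suc j))
        ≈⟨ +-cong (term-zero n f) (sumTo-cong n (term-suc n f)) ⟩
      c * term n f 0 + sumTo n (λ j → a * term n (f ∘ suc) j + c * term n f (suc j))
        ≈⟨ +-congˡ (trans (sumTo-distrib-+ n _ _) (+-cong (sym (*-distribˡ-sumTo n a _)) (sym (*-distribˡ-sumTo n c _)))) ⟩
      c * term n f 0 + (a * binomialSum n (f ∘ suc) + c * sumTo n (term n f ∘ suc))
        ≈⟨ solve 4 (λ c t s u → c ⊗ t ⊕ (s ⊕ c ⊗ u) ⊜ s ⊕ c ⊗ (t ⊕ u)) refl c _ _ _ ⟩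
      a * binomialSum n (f ∘ suc) + c * (term n f 0 + sumTo n (term n f ∘ suc))
        ≈⟨ +-congˡ (*-congˡ (sym (sumTo-unfoldˡ n (term n f)))) ⟩
      a * binomialSum n (f ∘ suc) + c * (binomialSum n f + term n f (suc n))
        ≈⟨ +-congˡ (*-congˡ (trans (+-congˡ (term-vanish n f)) (+-identityʳ _))) ⟩
      a * binomialSum n (f ∘ suc) + c * binomialSum n f ∎

    module _ (G : ℤ → Carrier) (s : ℕ) (shift : ∀ k → G (k +ℤ + s) ≈ a * G (k +ℤ + 1) + c * G k) where

      binomialSum-shift : ∀ n r → binomialSum n (λ j → G (+ j +ℤ r)) ≈ G (+ s *ℤ + n +ℤ r)
      binomialSum-shift zero r = begin
        (1# + 0#) * 1# * 1# * G (+ 0 +ℤ r)   ≈⟨ *-congʳ (trans (*-identityʳ _) (trans (*-identityʳ _) (+-identityʳ _))) ⟩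
        1# * G (+ 0 +ℤ r)                    ≈⟨ *-identityˡ _ ⟩
        G (+ 0 +ℤ r)                         ≡⟨ cong (λ i → G (i +ℤ r)) (ℤₚ.*-zeroʳ (+ s)) ⟨
        G (+ s *ℤ + 0 +ℤ r)                  ∎
      binomialSum-shift (suc n) r = begin
        binomialSum (suc n) (λ j → G (+ j +ℤ r))
          ≈⟨ binomialSum-suc n _ ⟩
        a * binomialSum n (λ j → G (+ suc j +ℤ r)) + c * binomialSum n (λ j → G (+ j +ℤ r))
          ≈⟨ +-congʳ (*-congˡ (binomialSum-cong n (λ j → reflexive (cong G (1+x+r≡x+[r+1] (+ j) r))))) ⟩
        a * binomialSum n (λ j → G (+ j +ℤ (r +ℤ + 1))) + c * binomialSum n (λ j → G (+ j +ℤ r))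
          ≈⟨ +-cong (*-congˡ (binomialSum-shift n (r +ℤ + 1))) (*-congˡ (binomialSum-shift n r)) ⟩
        a * G (+ s *ℤ + n +ℤ (r +ℤ + 1)) + c * G (+ s *ℤ + n +ℤ r)
          ≡⟨ cong (λ i → a * G i + c * G (+ s *ℤ + n +ℤ r)) (ℤₚ.+-assoc (+ s *ℤ + n) r (+ 1)) ⟨
        a * G (+ s *ℤ + n +ℤ r +ℤ + 1) + c * G (+ s *ℤ + n +ℤ r)
          ≈⟨ shift (+ s *ℤ + n +ℤ r) ⟨
        G (+ s *ℤ + n +ℤ r +ℤ + s)
          ≡⟨ cong G (s*n+r+s≡s*[1+n]+r (+ s) (+ n) r) ⟩
        G (+ s *ℤ + suc n +ℤ r) ∎

  module Recurrence (p₁ p₂ : Carrier) (F : ℤ → Carrier) (F₀ : F (+ 0) ≈ 0#) (F₁ : F (+ 1) ≈ 1#)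
                    (rec : ∀ k → F k ≈ p₁ * F (k -ℤ + 1) + p₂ * F (k -ℤ + 2)) where

    rec-forward : ∀ k → F (k +ℤ + 1 +ℤ + 1) ≈ p₁ * F (k +ℤ + 1) + p₂ * F k
    rec-forward k = begin
      F (k +ℤ + 1 +ℤ + 1)
        ≈⟨ rec _ ⟩
      p₁ * F (k +ℤ + 1 +ℤ + 1 -ℤ + 1) + p₂ * F (k +ℤ + 1 +ℤ + 1 -ℤ + 2)
        ≡⟨ cong₂ (λ i i′ → p₁ * F i + p₂ * F i′) (k+1+1-1≡k+1 k) (k+1+1-2≡k k) ⟩
      p₁ * F (k +ℤ + 1) + p₂ * F k ∎

    rec-ℕ : ∀ m → F (+ suc m) ≈ p₁ * F (+ m) + p₂ * F (+ m -ℤ + 1)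
    rec-ℕ m = trans (rec (+ suc m)) (reflexive (cong (λ i → p₁ * F (+ m) + p₂ * F i) (1+x-2≡x-1 (+ m))))

    p₂*F₋₁≈1 : p₂ * F -[1+ 0 ] ≈ 1#
    p₂*F₋₁≈1 = begin
      p₂ * F -[1+ 0 ]                   ≈⟨ +-identityˡ _ ⟨
      0# + p₂ * F -[1+ 0 ]              ≈⟨ +-congʳ (trans (*-congˡ F₀) (zeroʳ p₁)) ⟨
      p₁ * F (+ 0) + p₂ * F -[1+ 0 ]    ≈⟨ rec (+ 1) ⟨
      F (+ 1)                           ≈⟨ F₁ ⟩
      1#                                ∎

    F-add : ∀ m k → F (k +ℤ + m) ≈ F (+ m) * F (k +ℤ + 1) + p₂ * F (+ m -ℤ + 1) * F k
    F-add zero k = begin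
      F (k +ℤ + 0)                                  ≡⟨ cong F (ℤₚ.+-identityʳ k) ⟩
      F k                                           ≈⟨ *-identityˡ _ ⟨
      1# * F k                                      ≈⟨ *-congʳ p₂*F₋₁≈1 ⟨
      p₂ * F -[1+ 0 ] * F k                         ≈⟨ +-identityˡ _ ⟨
      0# + p₂ * F -[1+ 0 ] * F k                    ≈⟨ +-congʳ (trans (*-congʳ F₀) (zeroˡ _)) ⟨
      F (+ 0) * F (k +ℤ + 1) + p₂ * F -[1+ 0 ] * F k ∎
    F-add (suc m) k = begin
      F (k +ℤ + suc m)
        ≡⟨ cong F (k+[1+x]≡k+1+x k (+ m)) ⟩
      F (k +ℤ + 1 +ℤ + m)
        ≈⟨ F-add m (k +ℤ + 1) ⟩
      F (+ m) * F (k +ℤ + 1 +ℤ + 1) + p₂ * F (+ m -ℤ + 1) * F (k +ℤ + 1)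
        ≈⟨ +-congʳ (*-congˡ (rec-forward k)) ⟩
      F (+ m) * (p₁ * F (k +ℤ + 1) + p₂ * F k) + p₂ * F (+ m -ℤ + 1) * F (k +ℤ + 1)
        ≈⟨ solve 6 (λ u u′ v v′ p q → u ⊗ (p ⊗ v ⊕ q ⊗ v′) ⊕ q ⊗ u′ ⊗ v ⊜ (p ⊗ u ⊕ q ⊗ u′) ⊗ v ⊕ q ⊗ u ⊗ v′)
             refl (F (+ m)) (F (+ m -ℤ + 1)) (F (k +ℤ + 1)) (F k) p₁ p₂ ⟩
      (p₁ * F (+ m) + p₂ * F (+ m -ℤ + 1)) * F (k +ℤ + 1) + p₂ * F (+ m) * F k
        ≈⟨ +-congʳ (*-congʳ (rec-ℕ m)) ⟨
      F (+ suc m) * F (k +ℤ + 1) + p₂ * F (+ suc m -ℤ + 1) * F k ∎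

    corollarySum : ℕ → ℕ → ℤ → Carrier
    corollarySum m n d = sumTo n (λ j → pow p₂ (n ∸ j) * binom n j * pow (F (+ m)) j
                                    * pow (F (+ m -ℤ + 1)) (n ∸ j) * F (+ j -ℤ (+ m *ℤ + n) +ℤ d))

    corollarySum≈F : ∀ m n d → corollarySum m n d ≈ F d
    corollarySum≈F m n d = begin
      corollarySum m n d
        ≈⟨ sumTo-cong n summand≈term ⟩
      binomialSum n (λ j → F (+ j +ℤ (-ℤ X +ℤ d)))
        ≈⟨ binomialSum-shift F m (F-add m) n (-ℤ X +ℤ d) ⟩
      F (X +ℤ (-ℤ X +ℤ d))
        ≡⟨ cong F (x+[-x+d]≡d X d) ⟩
      F d ∎
      where
      X : ℤ
      X = + m *ℤ + n
      b : Carrier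
      b = F (+ m -ℤ + 1)
      open BinomialSum (F (+ m)) (p₂ * b)
      summand≈term : ∀ j → pow p₂ (n ∸ j) * binom n j * pow (F (+ m)) j * pow b (n ∸ j) * F (+ j -ℤ X +ℤ d)
                           ≈ term n (λ i → F (+ i +ℤ (-ℤ X +ℤ d))) j
      summand≈term j = begin
        pow p₂ (n ∸ j) * binom n j * pow (F (+ m)) j * pow b (n ∸ j) * F (+ j -ℤ X +ℤ d)
          ≈⟨ *-solve 5 (λ u B A v Y → (((u · B) · A) · v) · Y ≐ ((B · A) · (u · v)) · Y)
               refl (pow p₂ (n ∸ j)) (binom n j) (pow (F (+ m)) j) (pow b (n ∸ j)) _ ⟩
        binom n j * pow (F (+ m)) j * (pow p₂ (n ∸ j) * pow b (n ∸ j)) * F (+ j -ℤ X +ℤ d)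
          ≈⟨ *-cong (*-congˡ (pow-distribʳ-* p₂ b (n ∸ j))) (reflexive (cong F (sym≡ (ℤₚ.+-assoc (+ j) (-ℤ X) d)))) ⟨
        term n (λ i → F (+ i +ℤ (-ℤ X +ℤ d))) j ∎

corollary4p3 : ∀ {c ℓ} (R : CommutativeRing c ℓ) → IsField R →
  let open CommutativeRing R
      open RingOps R
  in (p₁ p₂ : Carrier) → ¬ (p₁ ≈ 0#) → ¬ (p₂ ≈ 0#) →
     (F : ℤ → Carrier) → F (+ 0) ≈ 0# → F (+ 1) ≈ 1# →
     (∀ (k : ℤ) → F k ≈ p₁ * F (k -ℤ + 1) + p₂ * F (k -ℤ + 2)) →
     (m n : ℕ) → 1 ≤ m →
     (sumTo n (λ j → pow p₂ (n Data.Nat.∸ j Data.Nat.+ 1) * binom n j * pow (F (+ m)) j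
                      * pow (F (+ m -ℤ + 1)) (n Data.Nat.∸ j)
                      * F (+ j -ℤ (+ m *ℤ + n) -ℤ + 1)) ≈ 1#)
     × (sumTo n (λ j → pow p₂ (n Data.Nat.∸ j) * binom n j * pow (F (+ m)) j
                      * pow (F (+ m -ℤ + 1)) (n Data.Nat.∸ j)
                      * F (+ j -ℤ (+ m *ℤ + n))) ≈ 0#)
     × (sumTo n (λ j → pow p₂ (n Data.Nat.∸ j) * binom n j * pow (F (+ m)) j
                      * pow (F (+ m -ℤ + 1)) (n Data.Nat.∸ j)
                      * F (+ j -ℤ (+ m *ℤ + n) +ℤ + 1)) ≈ 1#)
corollary4p3 R _ p₁ p₂ _ _ F F₀ F₁ rec m n _ =
    trans (sumTo-cong n (λ j → pow-suc-pull p₂ (n ∸ j) _ _ _ _))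
      (trans (sym (*-distribˡ-sumTo n p₂ _))
        (trans (*-congˡ (corollarySum≈F m n -[1+ 0 ])) p₂*F₋₁≈1))
  , trans (sumTo-cong n (λ j → *-congˡ (reflexive (cong F (sym≡ (ℤₚ.+-identityʳ _))))))
      (trans (corollarySum≈F m n (+ 0)) F₀)
  , trans (corollarySum≈F m n (+ 1)) F₁
  where
  open CommutativeRing R
  open RingLemmas R
  open Recurrence p₁ p₂ F F₀ F₁ rec
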